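{- If $|J|=3p-3$, then $1-(p-1, J)-(p, J)+(2p-1, J)+(2p, J)\equiv 0 \pmod p$.
   Context: Let $p$ be an odd prime and let $J$ be a finite set of lattice points in the Euclidean plane. For a positive integer $n$ and a finite set $X$ of lattice points, $(n, X)$ denotes the number of $n$-element subsets of $X$ the sum of whose elements (taken coordinatewise) is divisible by $p$, i.e. is $\equiv (0,0) \pmod p$. -}

module Defs where

open import Data.Nat as ℕ using (ℕ)
open import Data.Integer as ℤ using (ℤ)
open import Data.Integer.Divisibility.Signed using () renaming (_∣_ to _∣ℤ_)
open import Data.Integer.Divisibility.Signed using (_∣?_)
open import Data.Product using (_×_; _,_; proj₁; proj₂)
open import Data.List using (List; []; _∷_; length; map; filter; foldr; _++_)
open import Relation.Nullary using (Dec; yes; no)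
open import Relation.Nullary.Decidable using (_×-dec_)

LatticePoint : Set
LatticePoint = ℤ × ℤ

pointSum : List LatticePoint → LatticePoint
pointSum = foldr (λ x s → (proj₁ x ℤ.+ proj₁ s , proj₂ x ℤ.+ proj₂ s)) (ℤ.0ℤ , ℤ.0ℤ)

-- All subsets of a finite set given as a duplicate-free list:
-- each element is either omitted or included (2^|X| sub-lists,
-- in bijection with the subsets of X when X has no duplicates).
subsets : {A : Set} → List A → List (List A)
subsets []       = [] ∷ []
subsets (x ∷ xs) = subsets xs ++ map (x ∷_) (subsets xs)

SumDivisible : ℕ → List LatticePoint → Set
SumDivisible p S = (ℤ.+ p ∣ℤ proj₁ (pointSum S)) × (ℤ.+ p ∣ℤ proj₂ (pointSum S))

sumDivisible? : (p : ℕ) → (S : List LatticePoint) → Dec (SumDivisible p S)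
sumDivisible? p S = (ℤ.+ p ∣? proj₁ (pointSum S)) ×-dec (ℤ.+ p ∣? proj₂ (pointSum S))

-- (n, X) in the paper (with the prime p as an explicit parameter):
-- the number of n-element subsets of X whose sum is ≡ (0,0) mod p.
count : (p n : ℕ) → List LatticePoint → ℕ
count p n X = length (filter (λ S → (length S ℕ.≟ n) ×-dec sumDivisible? p S) (subsets X))

{-# OPTIONS --safe #-}
-- Write [p ∣ y] for the indicator of p ∣ y and W(y) = (y - 1)(y - 2)⋯(y - (p - 1)). The roots of W are
-- exactly the nonzero residues, so W(y) ≡ W(0) [p ∣ y] (mod p) with p ∤ W(0). For a list X the alternating
-- sum Σ_{S ⊆ X} (-1)^|S| f(S) vanishes whenever f has degree < |X| as a polynomial in the multiplicities of
-- the elements of X. Taking X = (0,0) ∷ J, of length 3p - 2, and f(S) = W(a) W(b) W(|S|) with (a, b) = Σ S,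
-- of degree 3(p - 1), gives Σ_{S ⊆ X} (-1)^|S| [p ∣ Σ S] [p ∣ |S|] ≡ 0 (mod p), as in Chevalley-Warning.
-- Splitting off the point (0,0) turns this sum into Σ_{S ⊆ J} (-1)^|S| [p ∣ Σ S] ([p ∣ |S|] - [p ∣ |S| + 1]);
-- since |S| ≤ 3p - 3, only the sizes 0, p - 1, p, 2p - 1, 2p contribute, and as p is odd their signs
-- are +, -, -, +, +.
module Submission where

module ChevalleyWarning where

  open import Defs
  open import Data.Bool using (true; false; if_then_else_)
  open import Data.Empty using (⊥-elim)
  open import Data.Integer as ℤ using (ℤ; _+_; _-_; _*_; -_; _^_; 0ℤ; 1ℤ; -1ℤ)
  import Data.Integer.Properties as ℤ
  open import Data.Integer.DivMod using (_%ℕ_; _/ℕ_; a≡a%ℕn+[a/ℕn]*n; n%ℕd<d)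
  open import Data.Integer.Divisibility.Signed
    using (_∣_; _∣?_; divides; ∣ᵤ⇒∣; ∣⇒∣ᵤ; ∣m⇒∣m*n; ∣n⇒∣m*n; ∣m∣n⇒∣m+n; ∣m∣n⇒∣m-n; ∣m⇒∣-m)
  open import Data.Integer.Tactic.RingSolver using (solve-∀)
  open import Data.List using (List; []; _∷_; _++_; map; filter; length)
  open import Data.List.Effectful.Foldable using (foldMap; ++-homo)
  open import Data.Nat as ℕ using (ℕ; zero; suc; _≤_; _<_; _∸_; z≤n; s≤s)
  import Data.Nat.Properties as ℕ
  import Data.Nat.Divisibility as ℕ
  import Data.Nat.DivMod as ℕ
  open import Data.Nat.Primality using (Prime; euclidsLemma; prime⇒irreducible; prime⇒nonZero; ¬prime[1])
  open import Data.Nat.Tactic.RingSolver using () renaming (solve-∀ to ℕ-solve-∀)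
  open import Data.Product using (_×_; _,_; proj₁; proj₂; ∃)
  open import Data.Sum using (_⊎_; inj₁; inj₂)
  open import Data.Unit using (⊤; tt)
  open import Function using (_∘_)
  open import Relation.Nullary using (Dec; yes; no; _because_; does; ¬_)
  open import Relation.Nullary.Decidable using (dec-true; dec-false; _×-dec_)
  open import Relation.Unary using (Pred; Decidable)
  open import Relation.Binary.PropositionalEquality

  𝟙 : {A : Set} → Dec A → ℤ
  𝟙 d = if does d then 1ℤ else 0ℤ

  𝟙-yes : {A : Set} (d : Dec A) → A → 𝟙 d ≡ 1ℤ
  𝟙-yes d a rewrite dec-true d a = refl

  𝟙-no : {A : Set} (d : Dec A) → ¬ A → 𝟙 d ≡ 0ℤ
  𝟙-no d ¬a rewrite dec-false d ¬a = refl

  𝟙-× : {A B : Set} (a : Dec A) (b : Dec B) → 𝟙 (a ×-dec b) ≡ 𝟙 a * 𝟙 b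
  𝟙-× (true  because _) b = sym (ℤ.*-identityˡ (𝟙 b))
  𝟙-× (false because _) b = refl

  𝟙[_≡_] : ℕ → ℕ → ℤ
  𝟙[ m ≡ n ] = 𝟙 (m ℕ.≟ n)

  𝟙[≡]-refl : ∀ n → 𝟙[ n ≡ n ] ≡ 1ℤ
  𝟙[≡]-refl n = 𝟙-yes (n ℕ.≟ n) refl

  𝟙[≢] : ∀ {m n} → m ≢ n → 𝟙[ m ≡ n ] ≡ 0ℤ
  𝟙[≢] {m} {n} = 𝟙-no (m ℕ.≟ n)

  𝟙[_∣_] : ℕ → ℤ → ℤ
  𝟙[ p ∣ y ] = 𝟙 (ℤ.+ p ∣? y)

  𝟙[∣] : ∀ {p y} → ℤ.+ p ∣ y → 𝟙[ p ∣ y ] ≡ 1ℤ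
  𝟙[∣] {p} {y} = 𝟙-yes (ℤ.+ p ∣? y)

  𝟙[∤] : ∀ {p y} → ¬ ℤ.+ p ∣ y → 𝟙[ p ∣ y ] ≡ 0ℤ
  𝟙[∤] {p} {y} = 𝟙-no (ℤ.+ p ∣? y)

  module _ {B : Set} where

    ∑ : List B → (B → ℤ) → ℤ
    ∑ xs g = foldMap ℤ.+-0-rawMonoid g xs

    ∑-++ : ∀ xs ys (g : B → ℤ) → ∑ (xs ++ ys) g ≡ ∑ xs g + ∑ ys g
    ∑-++ xs ys g = ++-homo ℤ.+-0-monoid g xs

    ∑-cong : ∀ xs {g h : B → ℤ} → (∀ b → g b ≡ h b) → ∑ xs g ≡ ∑ xs h
    ∑-cong []       g≡h = refl
    ∑-cong (x ∷ xs) g≡h = cong₂ _+_ (g≡h x) (∑-cong xs g≡h)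

    ∑-+ : ∀ xs (g h : B → ℤ) → ∑ xs (λ b → g b + h b) ≡ ∑ xs g + ∑ xs h
    ∑-+ []       g h = refl
    ∑-+ (x ∷ xs) g h =
      trans (cong ((g x + h x) +_) (∑-+ xs g h)) (interchange (g x) (h x) (∑ xs g) (∑ xs h))
      where
      interchange : ∀ a b c d → a + b + (c + d) ≡ a + c + (b + d)
      interchange = solve-∀

    ∑-neg : ∀ xs (g : B → ℤ) → ∑ xs (λ b → - g b) ≡ - ∑ xs g
    ∑-neg []       g = refl
    ∑-neg (x ∷ xs) g = trans (cong (- g x +_) (∑-neg xs g)) (sym (ℤ.neg-distrib-+ (g x) (∑ xs g)))

    ∑-sub : ∀ xs (g h : B → ℤ) → ∑ xs (λ b → g b - h b) ≡ ∑ xs g - ∑ xs h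
    ∑-sub xs g h = trans (∑-+ xs g (λ b → - h b)) (cong (∑ xs g +_) (∑-neg xs h))

    ∑-zero : ∀ xs → ∑ xs (λ (_ : B) → 0ℤ) ≡ 0ℤ
    ∑-zero []       = refl
    ∑-zero (x ∷ xs) = trans (ℤ.+-identityˡ _) (∑-zero xs)

    ∑-filter : ∀ {P : Pred B _} (P? : Decidable P) xs →
      ℤ.+ length (filter P? xs) ≡ ∑ xs (λ b → 𝟙 (P? b))
    ∑-filter P? []       = refl
    ∑-filter P? (x ∷ xs) with does (P? x)
    ... | true  = cong (1ℤ +_) (∑-filter P? xs)
    ... | false = trans (∑-filter P? xs) (sym (ℤ.+-identityˡ _))

  ∑-map : ∀ {B C : Set} (h : B → C) xs (g : C → ℤ) → ∑ (map h xs) g ≡ ∑ xs (g ∘ h)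
  ∑-map h []       g = refl
  ∑-map h (x ∷ xs) g = cong (g (h x) +_) (∑-map h xs g)

  module _ {A : Set} where

    ∑-subsets-∷ : ∀ x xs (g : List A → ℤ) →
      ∑ (subsets (x ∷ xs)) g ≡ ∑ (subsets xs) g + ∑ (subsets xs) (g ∘ (x ∷_))
    ∑-subsets-∷ x xs g =
      trans (∑-++ (subsets xs) _ g) (cong (∑ (subsets xs) g +_) (∑-map (x ∷_) (subsets xs) g))

    ∑-subsets-cong : ∀ xs {g h : List A → ℤ} → (∀ S → length S ≤ length xs → g S ≡ h S) →
      ∑ (subsets xs) g ≡ ∑ (subsets xs) h
    ∑-subsets-cong []       g≡h = cong (_+ 0ℤ) (g≡h [] z≤n)
    ∑-subsets-cong (x ∷ xs) {g} {h} g≡h = begin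
      ∑ (subsets (x ∷ xs)) g
        ≡⟨ ∑-subsets-∷ x xs g ⟩
      ∑ (subsets xs) g + ∑ (subsets xs) (g ∘ (x ∷_))
        ≡⟨ cong₂ _+_ (∑-subsets-cong xs λ S ≤xs → g≡h S (ℕ.m≤n⇒m≤1+n ≤xs))
                     (∑-subsets-cong xs λ S ≤xs → g≡h (x ∷ S) (s≤s ≤xs)) ⟩
      ∑ (subsets xs) h + ∑ (subsets xs) (h ∘ (x ∷_))
        ≡⟨ ∑-subsets-∷ x xs h ⟨
      ∑ (subsets (x ∷ xs)) h ∎
      where open ≡-Reasoning

    alternatingSum : List A → (List A → ℤ) → ℤ
    alternatingSum []       f = f []
    alternatingSum (x ∷ xs) f = alternatingSum xs f - alternatingSum xs (f ∘ (x ∷_))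

    alternatingSum≡∑ : ∀ xs (f : List A → ℤ) →
      alternatingSum xs f ≡ ∑ (subsets xs) (λ S → -1ℤ ^ length S * f S)
    alternatingSum≡∑ []       f = sym (trans (ℤ.+-identityʳ _) (ℤ.*-identityˡ (f [])))
    alternatingSum≡∑ (x ∷ xs) f = begin
      alternatingSum xs f - alternatingSum xs (f ∘ (x ∷_))
        ≡⟨ cong₂ _-_ (alternatingSum≡∑ xs f) (alternatingSum≡∑ xs (f ∘ (x ∷_))) ⟩
      ∑ (subsets xs) (signed f) - ∑ (subsets xs) (signed (f ∘ (x ∷_)))
        ≡⟨ cong (_+_ (∑ (subsets xs) (signed f))) (∑-neg (subsets xs) (signed (f ∘ (x ∷_)))) ⟨
      ∑ (subsets xs) (signed f) + ∑ (subsets xs) (λ S → - signed (f ∘ (x ∷_)) S)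
        ≡⟨ cong (_+_ (∑ (subsets xs) (signed f)))
                (∑-cong (subsets xs) (λ S → -[σa]≡[-1*σ]a (-1ℤ ^ length S) (f (x ∷ S)))) ⟩
      ∑ (subsets xs) (signed f) + ∑ (subsets xs) (signed f ∘ (x ∷_))
        ≡⟨ ∑-subsets-∷ x xs (signed f) ⟨
      ∑ (subsets (x ∷ xs)) (signed f) ∎
      where
      open ≡-Reasoning
      signed : (List A → ℤ) → List A → ℤ
      signed g S = -1ℤ ^ length S * g S
      -[σa]≡[-1*σ]a : ∀ σ a → - (σ * a) ≡ -1ℤ * σ * a
      -[σa]≡[-1*σ]a = solve-∀

    alternatingSum-cong : ∀ xs {f g : List A → ℤ} → (∀ S → f S ≡ g S) →
      alternatingSum xs f ≡ alternatingSum xs g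
    alternatingSum-cong []       f≡g = f≡g []
    alternatingSum-cong (x ∷ xs) f≡g =
      cong₂ _-_ (alternatingSum-cong xs f≡g) (alternatingSum-cong xs (f≡g ∘ (x ∷_)))

    alternatingSum-sub : ∀ xs (f g : List A → ℤ) →
      alternatingSum xs (λ S → f S - g S) ≡ alternatingSum xs f - alternatingSum xs g
    alternatingSum-sub []       f g = refl
    alternatingSum-sub (x ∷ xs) f g = trans
      (cong₂ _-_ (alternatingSum-sub xs f g) (alternatingSum-sub xs (f ∘ (x ∷_)) (g ∘ (x ∷_))))
      (interchange (alternatingSum xs f) (alternatingSum xs g)
                   (alternatingSum xs (f ∘ (x ∷_))) (alternatingSum xs (g ∘ (x ∷_))))
      where
      interchange : ∀ a b c d → (a - b) - (c - d) ≡ (a - c) - (b - d)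
      interchange = solve-∀

    alternatingSum-*ˡ : ∀ xs (c : ℤ) (f : List A → ℤ) →
      alternatingSum xs (λ S → c * f S) ≡ c * alternatingSum xs f
    alternatingSum-*ˡ []       c f = refl
    alternatingSum-*ˡ (x ∷ xs) c f = trans
      (cong₂ _-_ (alternatingSum-*ˡ xs c f) (alternatingSum-*ˡ xs c (f ∘ (x ∷_))))
      (factor c (alternatingSum xs f) (alternatingSum xs (f ∘ (x ∷_))))
      where
      factor : ∀ c a b → c * a - c * b ≡ c * (a - b)
      factor = solve-∀

    Δ : A → (List A → ℤ) → List A → ℤ
    Δ x f S = f (x ∷ S) - f S

    -- f has degree at most d as a function of the multiplicities with which the elements of xs
    -- occur in its argument.
    Degree≤ : ℕ → List A → (List A → ℤ) → Set
    Degree≤ d       []       f = ⊤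
    Degree≤ zero    (x ∷ xs) f = Degree≤ zero xs f × (∀ S → f (x ∷ S) ≡ f S)
    Degree≤ (suc d) (x ∷ xs) f = Degree≤ (suc d) xs f × Degree≤ d xs (Δ x f)

    Degree≤-cong : ∀ d xs {f g : List A → ℤ} → (∀ S → f S ≡ g S) → Degree≤ d xs f → Degree≤ d xs g
    Degree≤-cong d       []       f≡g _              = tt
    Degree≤-cong zero    (x ∷ xs) f≡g (deg , const) =
      Degree≤-cong zero xs f≡g deg , λ S → trans (sym (f≡g (x ∷ S))) (trans (const S) (f≡g S))
    Degree≤-cong (suc d) (x ∷ xs) f≡g (deg , Δdeg)  =
      Degree≤-cong (suc d) xs f≡g deg , Degree≤-cong d xs (λ S → cong₂ _-_ (f≡g (x ∷ S)) (f≡g S)) Δdeg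

    Degree≤-const : ∀ d xs (c : ℤ) → Degree≤ d xs (λ _ → c)
    Degree≤-const d       []       c = tt
    Degree≤-const zero    (x ∷ xs) c = Degree≤-const zero xs c , λ _ → refl
    Degree≤-const (suc d) (x ∷ xs) c =
      Degree≤-const (suc d) xs c , Degree≤-cong d xs (λ _ → sym (ℤ.+-inverseʳ c)) (Degree≤-const d xs 0ℤ)

    Degree≤-+ : ∀ d xs {f g : List A → ℤ} → Degree≤ d xs f → Degree≤ d xs g →
      Degree≤ d xs (λ S → f S + g S)
    Degree≤-+ d       []       _               _               = tt
    Degree≤-+ zero    (x ∷ xs) (degf , constf) (degg , constg) =
      Degree≤-+ zero xs degf degg , λ S → cong₂ _+_ (constf S) (constg S)
    Degree≤-+ (suc d) (x ∷ xs) {f} {g} (degf , Δdegf) (degg , Δdegg) =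
      Degree≤-+ (suc d) xs degf degg ,
      Degree≤-cong d xs (λ S → Δ-+ (f (x ∷ S)) (f S) (g (x ∷ S)) (g S)) (Degree≤-+ d xs Δdegf Δdegg)
      where
      Δ-+ : ∀ a b c d → (a - b) + (c - d) ≡ (a + c) - (b + d)
      Δ-+ = solve-∀

    Degree≤-suc : ∀ d xs {f : List A → ℤ} → Degree≤ d xs f → Degree≤ (suc d) xs f
    Degree≤-suc d       []       _                    = tt
    Degree≤-suc zero    (x ∷ xs) {f} (deg , const) =
      Degree≤-suc zero xs deg ,
      Degree≤-cong zero xs (λ S → sym (trans (cong (_- f S) (const S)) (ℤ.+-inverseʳ (f S))))
                           (Degree≤-const zero xs 0ℤ)
    Degree≤-suc (suc d) (x ∷ xs) (deg , Δdeg)       = Degree≤-suc (suc d) xs deg , Degree≤-suc d xs Δdeg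

    Degree≤-shift : ∀ d x xs {f : List A → ℤ} → Degree≤ d (x ∷ xs) f → Degree≤ d xs (f ∘ (x ∷_))
    Degree≤-shift zero    x xs (deg , const)    = Degree≤-cong zero xs (sym ∘ const) deg
    Degree≤-shift (suc d) x xs {f} (deg , Δdeg) =
      Degree≤-cong (suc d) xs (λ S → m+[n-m]≡n (f S) (f (x ∷ S)))
                              (Degree≤-+ (suc d) xs deg (Degree≤-suc d xs Δdeg))
      where
      m+[n-m]≡n : ∀ m n → m + (n - m) ≡ n
      m+[n-m]≡n = solve-∀

    -- By the Leibniz rule Δ x (f g) = Δ x f · g (x ∷ _) + f · Δ x g.
    Degree≤-* : ∀ d e xs {f g : List A → ℤ} → Degree≤ d xs f → Degree≤ e xs g →
      Degree≤ (d ℕ.+ e) xs (λ S → f S * g S)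
    Degree≤-* d e [] _ _ = tt
    Degree≤-* zero zero (x ∷ xs) (degf , constf) (degg , constg) =
      Degree≤-* zero zero xs degf degg , λ S → cong₂ _*_ (constf S) (constg S)
    Degree≤-* zero (suc e) (x ∷ xs) {f} {g} (degf , constf) (degg , Δdegg) =
      Degree≤-* zero (suc e) xs degf degg ,
      Degree≤-cong e xs (λ S → trans (leibniz (f S) (g (x ∷ S)) (g S))
                                     (cong (λ t → t * g (x ∷ S) - f S * g S) (sym (constf S))))
                        (Degree≤-* zero e xs degf Δdegg)
      where
      leibniz : ∀ a b c → a * (b - c) ≡ a * b - a * c
      leibniz = solve-∀
    Degree≤-* (suc d) zero (x ∷ xs) {f} {g} (degf , Δdegf) (degg , constg) =
      Degree≤-* (suc d) zero xs degf degg ,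
      Degree≤-cong (d ℕ.+ zero) xs (λ S → trans (leibniz (f (x ∷ S)) (f S) (g S))
                                                (cong (λ t → f (x ∷ S) * t - f S * g S) (sym (constg S))))
                                   (Degree≤-* d zero xs Δdegf degg)
      where
      leibniz : ∀ a b c → (a - b) * c ≡ a * c - b * c
      leibniz = solve-∀
    Degree≤-* (suc d) (suc e) (x ∷ xs) {f} {g} (degf , Δdegf) (degg , Δdegg) =
      Degree≤-* (suc d) (suc e) xs degf degg ,
      Degree≤-cong (d ℕ.+ suc e) xs (λ S → leibniz (f (x ∷ S)) (f S) (g (x ∷ S)) (g S))
        (Degree≤-+ (d ℕ.+ suc e) xs
          (Degree≤-* d (suc e) xs Δdegf (Degree≤-shift (suc e) x xs (degg , Δdegg)))
          (subst (λ k → Degree≤ k xs (λ S → f S * Δ x g S)) (sym (ℕ.+-suc d e))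
                 (Degree≤-* (suc d) e xs degf Δdegg)))
      where
      leibniz : ∀ a b c d → (a - b) * c + b * (c - d) ≡ a * c - b * d
      leibniz = solve-∀

    Degree≤-affine : ∀ xs (w : A → ℤ) (ℓ : List A → ℤ) → (∀ x S → ℓ (x ∷ S) ≡ w x + ℓ S) →
      Degree≤ 1 xs ℓ
    Degree≤-affine []       w ℓ ℓ-∷ = tt
    Degree≤-affine (x ∷ xs) w ℓ ℓ-∷ =
      Degree≤-affine xs w ℓ ℓ-∷ ,
      Degree≤-cong zero xs (λ S → sym (trans (cong (_- ℓ S) (ℓ-∷ x S)) ([m+n]-n≡m (w x) (ℓ S))))
                           (Degree≤-const zero xs (w x))
      where
      [m+n]-n≡m : ∀ m n → (m + n) - n ≡ m
      [m+n]-n≡m = solve-∀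

    alternatingSum-vanishes : ∀ d xs {f : List A → ℤ} → Degree≤ d xs f → d < length xs →
      alternatingSum xs f ≡ 0ℤ
    alternatingSum-vanishes zero    (x ∷ xs) {f} (_ , const) _ =
      trans (cong (_-_ (alternatingSum xs f)) (alternatingSum-cong xs const))
            (ℤ.+-inverseʳ (alternatingSum xs f))
    alternatingSum-vanishes (suc d) (x ∷ xs) {f} (_ , Δdeg) (s≤s d<xs) = begin
      alternatingSum xs f - alternatingSum xs (f ∘ (x ∷_))
        ≡⟨ a-b≡-[b-a] (alternatingSum xs f) (alternatingSum xs (f ∘ (x ∷_))) ⟩
      - (alternatingSum xs (f ∘ (x ∷_)) - alternatingSum xs f)
        ≡⟨ cong -_ (alternatingSum-sub xs (f ∘ (x ∷_)) f) ⟨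
      - alternatingSum xs (Δ x f)
        ≡⟨ cong -_ (alternatingSum-vanishes d xs Δdeg d<xs) ⟩
      0ℤ ∎
      where
      open ≡-Reasoning
      a-b≡-[b-a] : ∀ a b → a - b ≡ - (b - a)
      a-b≡-[b-a] = solve-∀

  infix 4 _≡_mod_

  _≡_mod_ : ℤ → ℤ → ℤ → Set
  a ≡ b mod m = m ∣ a - b

  *-cong-mod : ∀ {m a a′ b b′} → a ≡ a′ mod m → b ≡ b′ mod m → a * b ≡ a′ * b′ mod m
  *-cong-mod {m} {a} {a′} {b} {b′} a≡a′ b≡b′ =
    subst (m ∣_) (expand a a′ b b′) (∣m∣n⇒∣m+n (∣m⇒∣m*n b a≡a′) (∣n⇒∣m*n a′ b≡b′))
    where
    expand : ∀ a a′ b b′ → (a - a′) * b + a′ * (b - b′) ≡ a * b - a′ * b′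
    expand = solve-∀

  alternatingSum-cong-mod : ∀ {A : Set} {m} xs {f g : List A → ℤ} → (∀ S → f S ≡ g S mod m) →
    alternatingSum xs f ≡ alternatingSum xs g mod m
  alternatingSum-cong-mod []       f≡g = f≡g []
  alternatingSum-cong-mod {m = m} (x ∷ xs) {f} {g} f≡g =
    subst (m ∣_) (interchange (alternatingSum xs f) (alternatingSum xs g)
                              (alternatingSum xs (f ∘ (x ∷_))) (alternatingSum xs (g ∘ (x ∷_))))
      (∣m∣n⇒∣m-n (alternatingSum-cong-mod xs f≡g) (alternatingSum-cong-mod xs (f≡g ∘ (x ∷_))))
    where
    interchange : ∀ a b c d → (a - b) - (c - d) ≡ (a - c) - (b - d)
    interchange = solve-∀

  rootProduct : ℕ → ℤ → ℤ
  rootProduct zero    y = 1ℤ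
  rootProduct (suc k) y = (y - ℤ.+ suc k) * rootProduct k y

  rootProduct-cong-mod : ∀ {m} k y y′ → y ≡ y′ mod m → rootProduct k y ≡ rootProduct k y′ mod m
  rootProduct-cong-mod zero        y y′ _    = divides 0ℤ refl
  rootProduct-cong-mod {m} (suc k) y y′ y≡y′ =
    *-cong-mod {a = y - ℤ.+ suc k} {y′ - ℤ.+ suc k}
      (subst (m ∣_) (cancel y y′ (ℤ.+ suc k)) y≡y′) (rootProduct-cong-mod k y y′ y≡y′)
    where
    cancel : ∀ a b c → a - b ≡ (a - c) - (b - c)
    cancel = solve-∀

  rootProduct-root : ∀ {m} k c {y} → 1 ≤ c → c ≤ k → y ≡ ℤ.+ c mod m → m ∣ rootProduct k y
  rootProduct-root zero    c     1≤c c≤0   _   = ⊥-elim (ℕ.<⇒≱ 1≤c c≤0)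
  rootProduct-root (suc k) c {y} 1≤c c≤1+k y≡c with c ℕ.≟ suc k
  ... | yes refl  = ∣m⇒∣m*n (rootProduct k y) y≡c
  ... | no  c≢1+k =
    ∣n⇒∣m*n (y - ℤ.+ suc k) (rootProduct-root k c 1≤c (ℕ.≤-pred (ℕ.≤∧≢⇒< c≤1+k c≢1+k)) y≡c)

  Degree≤-rootProduct : ∀ {A : Set} k xs {ℓ : List A → ℤ} → Degree≤ 1 xs ℓ →
    Degree≤ k xs (rootProduct k ∘ ℓ)
  Degree≤-rootProduct zero    xs deg = Degree≤-const zero xs 1ℤ
  Degree≤-rootProduct (suc k) xs deg =
    Degree≤-* 1 k xs (Degree≤-+ 1 xs deg (Degree≤-const 1 xs (- ℤ.+ suc k))) (Degree≤-rootProduct k xs deg)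

  module _ {p : ℕ} (p-prime : Prime p) where

    private
      instance
        p≢0 : ℕ.NonZero p
        p≢0 = prime⇒nonZero p-prime

    prime∣*⇒∣⊎∣ : ∀ a b → ℤ.+ p ∣ a * b → ℤ.+ p ∣ a ⊎ ℤ.+ p ∣ b
    prime∣*⇒∣⊎∣ a b p∣ab
      with euclidsLemma ℤ.∣ a ∣ ℤ.∣ b ∣ p-prime (subst (p ℕ.∣_) (ℤ.abs-* a b) (∣⇒∣ᵤ p∣ab))
    ... | inj₁ p∣a = inj₁ (∣ᵤ⇒∣ p∣a)
    ... | inj₂ p∣b = inj₂ (∣ᵤ⇒∣ p∣b)

    prime∤* : ∀ {a b} → ¬ ℤ.+ p ∣ a → ¬ ℤ.+ p ∣ b → ¬ ℤ.+ p ∣ a * b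
    prime∤* {a} {b} p∤a p∤b p∣ab with prime∣*⇒∣⊎∣ a b p∣ab
    ... | inj₁ p∣a = p∤a p∣a
    ... | inj₂ p∣b = p∤b p∣b

    prime∤*-cancel : ∀ {c a} → ¬ ℤ.+ p ∣ c → ℤ.+ p ∣ c * a → ℤ.+ p ∣ a
    prime∤*-cancel {c} {a} p∤c p∣ca with prime∣*⇒∣⊎∣ c a p∣ca
    ... | inj₁ p∣c = ⊥-elim (p∤c p∣c)
    ... | inj₂ p∣a = p∣a

    prime∤rootProduct[0] : ∀ k → k < p → ¬ ℤ.+ p ∣ rootProduct k 0ℤ
    prime∤rootProduct[0] zero    _   p∣1 = ¬prime[1] (subst Prime (ℕ.∣1⇒≡1 (∣⇒∣ᵤ p∣1)) p-prime)
    prime∤rootProduct[0] (suc k) k<p p∣W with prime∣*⇒∣⊎∣ (0ℤ - ℤ.+ suc k) (rootProduct k 0ℤ) p∣W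
    ... | inj₁ p∣k  = ℕ.<⇒≱ k<p (ℕ.∣⇒≤ (∣⇒∣ᵤ p∣k))
    ... | inj₂ p∣W′ = prime∤rootProduct[0] k (ℕ.<-trans (ℕ.n<1+n k) k<p) p∣W′

    prime∣rootProduct : ∀ {y} → ¬ ℤ.+ p ∣ y → ℤ.+ p ∣ rootProduct (p ∸ 1) y
    prime∣rootProduct {y} p∤y = rootProduct-root (p ∸ 1) r 1≤r r≤p-1 y≡r
      where
      r = y %ℕ p
      y≡r+[y/p]*p : y ≡ ℤ.+ r + y /ℕ p * ℤ.+ p
      y≡r+[y/p]*p = a≡a%ℕn+[a/ℕn]*n y p
      y≡r : y ≡ ℤ.+ r mod ℤ.+ p
      y≡r = divides (y /ℕ p) (trans (cong (_- ℤ.+ r) y≡r+[y/p]*p) ([m+n]-m≡n (ℤ.+ r) _))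
        where
        [m+n]-m≡n : ∀ m n → m + n - m ≡ n
        [m+n]-m≡n = solve-∀
      1≤r : 1 ≤ r
      1≤r with r in r≡
      ... | suc _ = s≤s z≤n
      ... | zero  = ⊥-elim (p∤y (divides (y /ℕ p)
        (trans y≡r+[y/p]*p (trans (cong (λ t → ℤ.+ t + y /ℕ p * ℤ.+ p) r≡) (ℤ.+-identityˡ _)))))
      r≤p-1 : r ≤ p ∸ 1
      r≤p-1 = ℕ.≤-pred (subst (suc r ≤_) (sym (ℕ.suc-pred p)) (n%ℕd<d y p))

    rootProduct≡𝟙 : ∀ y → rootProduct (p ∸ 1) y ≡ rootProduct (p ∸ 1) 0ℤ * 𝟙[ p ∣ y ] mod ℤ.+ p
    rootProduct≡𝟙 y with ℤ.+ p ∣? y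
    ... | yes p∣y rewrite 𝟙[∣] p∣y | ℤ.*-identityʳ (rootProduct (p ∸ 1) 0ℤ) =
      rootProduct-cong-mod (p ∸ 1) y 0ℤ (subst (ℤ.+ p ∣_) (sym (ℤ.+-identityʳ y)) p∣y)
    ... | no  p∤y rewrite 𝟙[∤] p∤y | ℤ.*-zeroʳ (rootProduct (p ∸ 1) 0ℤ)
                        | ℤ.+-identityʳ (rootProduct (p ∸ 1) y) = prime∣rootProduct p∤y

    chevalleyWarning₃ : ∀ {A : Set} (xs : List A) {ℓ₁ ℓ₂ ℓ₃ : List A → ℤ} →
      Degree≤ 1 xs ℓ₁ → Degree≤ 1 xs ℓ₂ → Degree≤ 1 xs ℓ₃ → 3 ℕ.* (p ∸ 1) < length xs →
      ℤ.+ p ∣ alternatingSum xs (λ S → 𝟙[ p ∣ ℓ₁ S ] * 𝟙[ p ∣ ℓ₂ S ] * 𝟙[ p ∣ ℓ₃ S ])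
    chevalleyWarning₃ xs {ℓ₁} {ℓ₂} {ℓ₃} deg₁ deg₂ deg₃ 3[p-1]<xs =
      prime∤*-cancel (prime∤* (prime∤* p∤K p∤K) p∤K) p∣K³alt[H]
      where
      m = p ∸ 1
      R = rootProduct m
      K = R 0ℤ
      H Q : List _ → ℤ
      H S = 𝟙[ p ∣ ℓ₁ S ] * 𝟙[ p ∣ ℓ₂ S ] * 𝟙[ p ∣ ℓ₃ S ]
      Q S = R (ℓ₁ S) * R (ℓ₂ S) * R (ℓ₃ S)

      p∤K : ¬ ℤ.+ p ∣ K
      p∤K = prime∤rootProduct[0] m (ℕ.≤-reflexive (ℕ.suc-pred p))

      alt[Q]≡0 : alternatingSum xs Q ≡ 0ℤ
      alt[Q]≡0 = alternatingSum-vanishes (m ℕ.+ m ℕ.+ m) xs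
        (Degree≤-* (m ℕ.+ m) m xs
          (Degree≤-* m m xs (Degree≤-rootProduct m xs deg₁) (Degree≤-rootProduct m xs deg₂))
          (Degree≤-rootProduct m xs deg₃))
        (subst (_< length xs) (3*m≡m+m+m m) 3[p-1]<xs)
        where
        3*m≡m+m+m : ∀ m → 3 ℕ.* m ≡ m ℕ.+ m ℕ.+ m
        3*m≡m+m+m = ℕ-solve-∀

      Q≡K³H : ∀ S → Q S ≡ K * K * K * H S mod ℤ.+ p
      Q≡K³H S =
        subst (λ t → Q S ≡ t mod ℤ.+ p) (regroup K 𝟙[ p ∣ ℓ₁ S ] 𝟙[ p ∣ ℓ₂ S ] 𝟙[ p ∣ ℓ₃ S ])
          (*-cong-mod {a = R (ℓ₁ S) * R (ℓ₂ S)} {K * 𝟙[ p ∣ ℓ₁ S ] * (K * 𝟙[ p ∣ ℓ₂ S ])}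
            (*-cong-mod {a = R (ℓ₁ S)} {K * 𝟙[ p ∣ ℓ₁ S ]} (rootProduct≡𝟙 (ℓ₁ S)) (rootProduct≡𝟙 (ℓ₂ S)))
            (rootProduct≡𝟙 (ℓ₃ S)))
        where
        regroup : ∀ k a b c → k * a * (k * b) * (k * c) ≡ k * k * k * (a * b * c)
        regroup = solve-∀

      alt[Q]≡K³alt[H] : alternatingSum xs Q ≡ K * K * K * alternatingSum xs H mod ℤ.+ p
      alt[Q]≡K³alt[H] = subst (λ t → alternatingSum xs Q ≡ t mod ℤ.+ p) (alternatingSum-*ˡ xs (K * K * K) H)
                              (alternatingSum-cong-mod xs Q≡K³H)

      p∣K³alt[H] : ℤ.+ p ∣ K * K * K * alternatingSum xs H
      p∣K³alt[H] = subst (ℤ.+ p ∣_) (-[0-x]≡x (K * K * K * alternatingSum xs H))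
        (∣m⇒∣-m (subst (λ t → t ≡ K * K * K * alternatingSum xs H mod ℤ.+ p) alt[Q]≡0 alt[Q]≡K³alt[H]))
        where
        -[0-x]≡x : ∀ x → - (0ℤ - x) ≡ x
        -[0-x]≡x = solve-∀

  pointSum₁ pointSum₂ : List LatticePoint → ℤ
  pointSum₁ S = proj₁ (pointSum S)
  pointSum₂ S = proj₂ (pointSum S)

  origin : LatticePoint
  origin = 0ℤ , 0ℤ

  module _ (p : ℕ) where

    divisibleSum : List LatticePoint → ℤ
    divisibleSum S = 𝟙[ p ∣ pointSum₁ S ] * 𝟙[ p ∣ pointSum₂ S ]

    divisibleSumAndSize : List LatticePoint → ℤ
    divisibleSumAndSize S = divisibleSum S * 𝟙[ p ∣ ℤ.+ length S ]

    alternatingSum-origin∷ : ∀ J →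
      alternatingSum (origin ∷ J) divisibleSumAndSize ≡
      alternatingSum J (λ S → divisibleSum S * (𝟙[ p ∣ ℤ.+ length S ] - 𝟙[ p ∣ ℤ.+ suc (length S) ]))
    alternatingSum-origin∷ J =
      trans (sym (alternatingSum-sub J divisibleSumAndSize (divisibleSumAndSize ∘ (origin ∷_))))
            (alternatingSum-cong J λ S →
              trans (cong (λ c → divisibleSumAndSize S - c * 𝟙[ p ∣ ℤ.+ suc (length S) ])
                          (divisibleSum-origin∷ S))
                    (factor (divisibleSum S) 𝟙[ p ∣ ℤ.+ length S ] 𝟙[ p ∣ ℤ.+ suc (length S) ]))
      where
      divisibleSum-origin∷ : ∀ S → divisibleSum (origin ∷ S) ≡ divisibleSum S
      divisibleSum-origin∷ S = cong₂ (λ a b → 𝟙[ p ∣ a ] * 𝟙[ p ∣ b ])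
        (ℤ.+-identityˡ (pointSum₁ S)) (ℤ.+-identityˡ (pointSum₂ S))
      factor : ∀ c a b → c * a - c * b ≡ c * (a - b)
      factor = solve-∀

    count≡∑ : ∀ n J → ℤ.+ count p n J ≡ ∑ (subsets J) (λ S → 𝟙[ length S ≡ n ] * divisibleSum S)
    count≡∑ n J = trans (∑-filter _ (subsets J)) (∑-cong (subsets J) λ S →
      trans (𝟙-× (length S ℕ.≟ n) (sumDivisible? p S))
            (cong (𝟙[ length S ≡ n ] *_) (𝟙-× (ℤ.+ p ∣? pointSum₁ S) (ℤ.+ p ∣? pointSum₂ S))))

    count-zero : ∀ J → count p 0 J ≡ 1
    count-zero J = ℤ.+-injective (trans (count≡∑ 0 J) (∑-empty J))
      where
      ∑-empty : ∀ xs → ∑ (subsets xs) (λ S → 𝟙[ length S ≡ 0 ] * divisibleSum S) ≡ 1ℤ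
      ∑-empty []       rewrite 𝟙[∣] {p} {0ℤ} (divides 0ℤ refl) = refl
      ∑-empty (x ∷ xs) = trans (∑-subsets-∷ x xs _) (cong₂ _+_ (∑-empty xs) (∑-zero (subsets xs)))

  prime∣alternatingSum : ∀ {p} → Prime p → ∀ xs → 3 ℕ.* (p ∸ 1) < length xs →
    ℤ.+ p ∣ alternatingSum xs (divisibleSumAndSize p)
  prime∣alternatingSum p-prime xs = chevalleyWarning₃ p-prime xs
    (Degree≤-affine xs proj₁ pointSum₁ λ _ _ → refl)
    (Degree≤-affine xs proj₂ pointSum₂ λ _ _ → refl)
    (Degree≤-affine xs (λ _ → 1ℤ) (ℤ.+_ ∘ length) λ _ _ → refl)

  prime≢2⇒odd : ∀ {p} → Prime p → p ≢ 2 → ∃ λ q → p ≡ suc (2 ℕ.* q)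
  prime≢2⇒odd {p} p-prime p≢2 with p ℕ.% 2 | ℕ.m≡m%n+[m/n]*n p 2 | ℕ.m%n<n p 2
  ... | 0           | p≡[p/2]*2 | _ with prime⇒irreducible p-prime (ℕ.divides (p ℕ./ 2) p≡[p/2]*2)
  ...   | inj₂ 2≡p = ⊥-elim (p≢2 (sym 2≡p))
  prime≢2⇒odd {p} _ _ | 1 | p≡1+[p/2]*2 | _ = p ℕ./ 2 , trans p≡1+[p/2]*2 (cong suc (ℕ.*-comm (p ℕ./ 2) 2))
  prime≢2⇒odd {p} _ _ | suc (suc _) | _ | s≤s (s≤s ())

  ∤⇒≢ : ∀ {p m n} → ¬ ℤ.+ p ∣ ℤ.+ m → p ℕ.∣ n → m ≢ n
  ∤⇒≢ p∤m p∣n refl = p∤m (∣ᵤ⇒∣ p∣n)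

  -1^[2n]≡1 : ∀ n → -1ℤ ^ (2 ℕ.* n) ≡ 1ℤ
  -1^[2n]≡1 n = trans (sym (ℤ.^-*-assoc -1ℤ 2 n)) (ℤ.^-zeroˡ n)

  module _ (q : ℕ) where

    private
      p : ℕ
      p = suc (2 ℕ.* q)

    p≢2p : p ≢ 2 ℕ.* p
    p≢2p = ℕ.m+1+n≢m p ∘ sym

    multiple<3p : ∀ {m} → p ℕ.∣ m → m < 3 ℕ.* p → m ≡ 0 ⊎ m ≡ p ⊎ m ≡ 2 ℕ.* p
    multiple<3p (ℕ.divides k refl) k*p<3*p with ℕ.*-cancelʳ-< p k 3 k*p<3*p
    ... | s≤s z≤n             = inj₁ refl
    ... | s≤s (s≤s z≤n)       = inj₂ (inj₁ (ℕ.*-identityˡ p))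
    ... | s≤s (s≤s (s≤s z≤n)) = inj₂ (inj₂ refl)

    -1^m*𝟙[p∣m] : ∀ m → m < 3 ℕ.* p →
      -1ℤ ^ m * 𝟙[ p ∣ ℤ.+ m ] ≡ 𝟙[ m ≡ 0 ] - 𝟙[ m ≡ p ] + 𝟙[ m ≡ 2 ℕ.* p ]
    -1^m*𝟙[p∣m] m m<3p with ℤ.+ p ∣? ℤ.+ m
    ... | no p∤m rewrite 𝟙[∤] p∤m | 𝟙[≢] (∤⇒≢ p∤m (p ℕ.∣0)) | 𝟙[≢] (∤⇒≢ p∤m ℕ.∣-refl)
                       | 𝟙[≢] (∤⇒≢ p∤m (ℕ.n∣m*n 2)) = ℤ.*-zeroʳ (-1ℤ ^ m)
    ... | yes p∣m rewrite 𝟙[∣] p∣m with multiple<3p (∣⇒∣ᵤ p∣m) m<3p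
    ...   | inj₁ refl = refl
    ...   | inj₂ (inj₁ refl) rewrite 𝟙[≡]-refl p | 𝟙[≢] p≢2p =
      trans (ℤ.*-identityʳ (-1ℤ ^ p)) (cong (-1ℤ *_) (-1^[2n]≡1 q))
    ...   | inj₂ (inj₂ refl) rewrite 𝟙[≡]-refl (2 ℕ.* p) | 𝟙[≢] (p≢2p ∘ sym) =
      trans (ℤ.*-identityʳ (-1ℤ ^ (2 ℕ.* p))) (-1^[2n]≡1 p)

    -- 𝟙[ suc k ≡ suc n ] is definitionally 𝟙[ k ≡ n ], and both p and 2 p are successors.
    -1^k*Δ𝟙[p∣k] : ∀ k → suc k < 3 ℕ.* p →
      -1ℤ ^ k * (𝟙[ p ∣ ℤ.+ k ] - 𝟙[ p ∣ ℤ.+ suc k ]) ≡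
      𝟙[ k ≡ 0 ] - 𝟙[ k ≡ p ∸ 1 ] - 𝟙[ k ≡ p ] + 𝟙[ k ≡ 2 ℕ.* p ∸ 1 ] + 𝟙[ k ≡ 2 ℕ.* p ]
    -1^k*Δ𝟙[p∣k] k 1+k<3p = begin
      -1ℤ ^ k * (𝟙[ p ∣ ℤ.+ k ] - 𝟙[ p ∣ ℤ.+ suc k ])
        ≡⟨ distrib (-1ℤ ^ k) 𝟙[ p ∣ ℤ.+ k ] 𝟙[ p ∣ ℤ.+ suc k ] ⟩
      -1ℤ ^ k * 𝟙[ p ∣ ℤ.+ k ] + -1ℤ ^ suc k * 𝟙[ p ∣ ℤ.+ suc k ]
        ≡⟨ cong₂ _+_ (-1^m*𝟙[p∣m] k (ℕ.<-trans (ℕ.n<1+n k) 1+k<3p)) (-1^m*𝟙[p∣m] (suc k) 1+k<3p) ⟩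
      (𝟙[ k ≡ 0 ] - 𝟙[ k ≡ p ] + 𝟙[ k ≡ 2 ℕ.* p ])
        + (0ℤ - 𝟙[ k ≡ p ∸ 1 ] + 𝟙[ k ≡ 2 ℕ.* p ∸ 1 ])
        ≡⟨ rearrange 𝟙[ k ≡ 0 ] 𝟙[ k ≡ p ∸ 1 ] 𝟙[ k ≡ p ] 𝟙[ k ≡ 2 ℕ.* p ∸ 1 ] 𝟙[ k ≡ 2 ℕ.* p ] ⟩
      𝟙[ k ≡ 0 ] - 𝟙[ k ≡ p ∸ 1 ] - 𝟙[ k ≡ p ] + 𝟙[ k ≡ 2 ℕ.* p ∸ 1 ] + 𝟙[ k ≡ 2 ℕ.* p ] ∎
      where
      open ≡-Reasoning
      distrib : ∀ σ a b → σ * (a - b) ≡ σ * a + -1ℤ * σ * b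
      distrib = solve-∀
      rearrange : ∀ a b c d e → (a - c + e) + (0ℤ - b + d) ≡ a - b - c + d + e
      rearrange = solve-∀

    1+k<3p : ∀ {k} → k ≤ 3 ℕ.* p ∸ 3 → suc k < 3 ℕ.* p
    1+k<3p k≤3p-3 = ℕ.≤-trans (s≤s (s≤s k≤3p-3))
      (ℕ.≤-trans (ℕ.n≤1+n _) (ℕ.≤-reflexive (ℕ.m+[n∸m]≡n (ℕ.m≤m*n 3 p))))

    alternatingSum≡counts : ∀ J → length J ≡ 3 ℕ.* p ∸ 3 →
      alternatingSum (origin ∷ J) (divisibleSumAndSize p) ≡
      1ℤ - ℤ.+ count p (p ∸ 1) J - ℤ.+ count p p J + ℤ.+ count p (2 ℕ.* p ∸ 1) J + ℤ.+ count p (2 ℕ.* p) J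
    alternatingSum≡counts J |J|≡3p-3 = begin
      alternatingSum (origin ∷ J) (divisibleSumAndSize p)
        ≡⟨ alternatingSum-origin∷ p J ⟩
      alternatingSum J (λ S → divisibleSum p S * Δ𝟙[p∣] (length S))
        ≡⟨ alternatingSum≡∑ J _ ⟩
      ∑ (subsets J) (λ S → -1ℤ ^ length S * (divisibleSum p S * Δ𝟙[p∣] (length S)))
        ≡⟨ ∑-subsets-cong J signed-term ⟩
      ∑ (subsets J) (λ S → χ 0 S - χ (p ∸ 1) S - χ p S + χ (2 ℕ.* p ∸ 1) S + χ (2 ℕ.* p) S)
        ≡⟨ ∑-χ ⟩
      C 0 - C (p ∸ 1) - C p + C (2 ℕ.* p ∸ 1) + C (2 ℕ.* p)
        ≡⟨ cong₂ _+_ (cong₂ _+_ (cong₂ _-_ (cong₂ _-_ C[0]≡1 (C≡count (p ∸ 1))) (C≡count p))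
                                (C≡count (2 ℕ.* p ∸ 1)))
                     (C≡count (2 ℕ.* p)) ⟩
      1ℤ - ℤ.+ count p (p ∸ 1) J - ℤ.+ count p p J
         + ℤ.+ count p (2 ℕ.* p ∸ 1) J + ℤ.+ count p (2 ℕ.* p) J ∎
      where
      open ≡-Reasoning
      Δ𝟙[p∣] : ℕ → ℤ
      Δ𝟙[p∣] k = 𝟙[ p ∣ ℤ.+ k ] - 𝟙[ p ∣ ℤ.+ suc k ]
      χ : ℕ → List LatticePoint → ℤ
      χ n S = 𝟙[ length S ≡ n ] * divisibleSum p S
      C : ℕ → ℤ
      C n = ∑ (subsets J) (χ n)

      signed-term : ∀ S → length S ≤ length J →
        -1ℤ ^ length S * (divisibleSum p S * Δ𝟙[p∣] (length S)) ≡
        χ 0 S - χ (p ∸ 1) S - χ p S + χ (2 ℕ.* p ∸ 1) S + χ (2 ℕ.* p) S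
      signed-term S |S|≤|J| = begin
        -1ℤ ^ length S * (divisibleSum p S * Δ𝟙[p∣] (length S))
          ≡⟨ swap (-1ℤ ^ length S) (divisibleSum p S) (Δ𝟙[p∣] (length S)) ⟩
        divisibleSum p S * (-1ℤ ^ length S * Δ𝟙[p∣] (length S))
          ≡⟨ cong (divisibleSum p S *_)
                  (-1^k*Δ𝟙[p∣k] (length S) (1+k<3p (subst (length S ≤_) |J|≡3p-3 |S|≤|J|))) ⟩
        divisibleSum p S * (𝟙[ length S ≡ 0 ] - 𝟙[ length S ≡ p ∸ 1 ] - 𝟙[ length S ≡ p ]
                            + 𝟙[ length S ≡ 2 ℕ.* p ∸ 1 ] + 𝟙[ length S ≡ 2 ℕ.* p ])
          ≡⟨ distrib (divisibleSum p S) 𝟙[ length S ≡ 0 ] 𝟙[ length S ≡ p ∸ 1 ] 𝟙[ length S ≡ p ]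
                     𝟙[ length S ≡ 2 ℕ.* p ∸ 1 ] 𝟙[ length S ≡ 2 ℕ.* p ] ⟩
        χ 0 S - χ (p ∸ 1) S - χ p S + χ (2 ℕ.* p ∸ 1) S + χ (2 ℕ.* p) S ∎
        where
        swap : ∀ σ c x → σ * (c * x) ≡ c * (σ * x)
        swap = solve-∀
        distrib : ∀ c a b d e f → c * (a - b - d + e + f) ≡ a * c - b * c - d * c + e * c + f * c
        distrib = solve-∀

      ∑-χ : ∑ (subsets J) (λ S → χ 0 S - χ (p ∸ 1) S - χ p S + χ (2 ℕ.* p ∸ 1) S + χ (2 ℕ.* p) S)
            ≡ C 0 - C (p ∸ 1) - C p + C (2 ℕ.* p ∸ 1) + C (2 ℕ.* p)
      ∑-χ = begin
        ∑ (subsets J) (λ S → χ 0 S - χ (p ∸ 1) S - χ p S + χ (2 ℕ.* p ∸ 1) S + χ (2 ℕ.* p) S)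
          ≡⟨ ∑-+ (subsets J) (λ S → χ 0 S - χ (p ∸ 1) S - χ p S + χ (2 ℕ.* p ∸ 1) S) (χ (2 ℕ.* p)) ⟩
        ∑ (subsets J) (λ S → χ 0 S - χ (p ∸ 1) S - χ p S + χ (2 ℕ.* p ∸ 1) S) + C (2 ℕ.* p)
          ≡⟨ cong (_+ C (2 ℕ.* p))
                  (∑-+ (subsets J) (λ S → χ 0 S - χ (p ∸ 1) S - χ p S) (χ (2 ℕ.* p ∸ 1))) ⟩
        ∑ (subsets J) (λ S → χ 0 S - χ (p ∸ 1) S - χ p S) + C (2 ℕ.* p ∸ 1) + C (2 ℕ.* p)
          ≡⟨ cong (λ t → t + C (2 ℕ.* p ∸ 1) + C (2 ℕ.* p))
                  (∑-sub (subsets J) (λ S → χ 0 S - χ (p ∸ 1) S) (χ p)) ⟩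
        ∑ (subsets J) (λ S → χ 0 S - χ (p ∸ 1) S) - C p + C (2 ℕ.* p ∸ 1) + C (2 ℕ.* p)
          ≡⟨ cong (λ t → t - C p + C (2 ℕ.* p ∸ 1) + C (2 ℕ.* p)) (∑-sub (subsets J) (χ 0) (χ (p ∸ 1))) ⟩
        C 0 - C (p ∸ 1) - C p + C (2 ℕ.* p ∸ 1) + C (2 ℕ.* p) ∎

      C≡count : ∀ n → C n ≡ ℤ.+ count p n J
      C≡count n = sym (count≡∑ p n J)

      C[0]≡1 : C 0 ≡ 1ℤ
      C[0]≡1 = trans (C≡count 0) (cong ℤ.+_ (count-zero p J))

open import Defs
open import Data.Nat using (ℕ; _*_; _∸_; s≤s)
open import Data.Nat.Properties using (≤-reflexive; *-distribˡ-∸)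
open import Data.Nat.Primality using (Prime)
import Data.Integer as ℤ
open import Data.Integer.Divisibility.Signed using () renaming (_∣_ to _∣ℤ_)
open import Data.List using (List; length; _∷_)
open import Data.List.Relation.Unary.Unique.Propositional using (Unique)
open import Data.Product using (_,_)
open import Relation.Nullary using (¬_)
open import Relation.Binary.PropositionalEquality using (_≡_; refl; sym; trans; subst)
open ChevalleyWarning

corollary1 : (p : ℕ) → Prime p → ¬ (p ≡ 2) →
    (J : List LatticePoint) → Unique J → length J ≡ 3 * p ∸ 3 →
    ℤ.+ p ∣ℤ (((ℤ.1ℤ ℤ.- ℤ.+ count p (p ∸ 1) J) ℤ.- ℤ.+ count p p J)
    ℤ.+ ℤ.+ count p (2 * p ∸ 1) J ℤ.+ ℤ.+ count p (2 * p) J)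
corollary1 p p-prime p≢2 J _ |J|≡3p-3 with prime≢2⇒odd p-prime p≢2
... | q , refl = subst (ℤ.+ p ∣ℤ_) (alternatingSum≡counts q J |J|≡3p-3)
  (prime∣alternatingSum p-prime (origin ∷ J)
    (s≤s (≤-reflexive (trans (*-distribˡ-∸ 3 p 1) (sym |J|≡3p-3)))))
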